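{- Let $k\geq 3$ and $1\leq r\leq k-1$ be integers and let $G_{k,r}$, $U$, $U_0$, $V_1,\dots,V_r$ be as defined in the context. Let $X$ be any dominating set of $G_{k,r}$. Then (a) $X\cap U_0\neq\varnothing$; (b) if $U\not\subseteq X$, then $X\cap V_i\neq\varnothing$ for each $i\in\{1,\dots,r\}$. If moreover $X$ is a minimal dominating set, then (c) $|X\cap V_i|\leq 1$ for each $i\in\{1,\dots,r\}$; (d) if $u_0\in X$ then $X\cap U_0=\{u_0\}$; (e) if $X\cap V_i=\varnothing$ for some $i$, then $X=U$.
   Context: The graph $G_{k,r}$ (for integers $k\geq3$, $1\leq r\leq k-1$) has vertex set $U\cup\{u_0\}\cup V_1\cup\dots\cup V_r$, where $U=\{u_1,\dots,u_k\}$ and $V_i=\{v_{i,1},\dots,v_{i,k}\}$ for $i=1,\dots,r$ (all distinct). Its edges: $U$ is a clique; each $V_i$ is a clique; $u_j$ is adjacent to $v_{i,j}$ for all $i\in\{1,\dots,r\}$, $j\in\{1,\dots,k\}$; and $u_0$ is adjacent to every vertex of $U$. There are no other edges (i.e. $G_{k,r}$ is the Cartesian product $K_k\,\square\,K_{1,r}$, with $U$ the copy of $K_k$ at the centre of $K_{1,r}$, plus a vertex $u_0$ joined to $U$). Let $U_0=U\cup\{u_0\}$. A dominating set is minimal if no proper subset is dominating. -}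

module Defs where

open import Data.Nat using (ℕ; suc)
open import Data.Fin using (Fin)
open import Data.Bool using (Bool; true; false)
open import Data.Product using (Σ; ∃; _×_; _,_)
open import Data.Sum using (_⊎_)
open import Data.Unit using (⊤)
open import Data.Empty using (⊥)
open import Data.List using (List; filter; length)
open import Data.List.Base using (allFin)
open import Data.Bool.Properties using (_≟_)
open import Relation.Binary.PropositionalEquality using (_≡_; _≢_)
open import Relation.Nullary using (¬_)

-- Vertices of G_{k,r}:  u j  (j ∈ Fin k) is u_{j+1},  u0 is u_0,
-- v i j  (i ∈ Fin r, j ∈ Fin k) is v_{i+1,j+1}.
data Vertex (k r : ℕ) : Set where
  u  : Fin k → Vertex k r
  u0 : Vertex k r
  v  : Fin r → Fin k → Vertex k r

data Adj {k r : ℕ} : Vertex k r → Vertex k r → Set where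
  uu  : ∀ {j j'} → j ≢ j' → Adj (u j) (u j')
  vv  : ∀ {i j j'} → j ≢ j' → Adj (v i j) (v i j')
  uv  : ∀ {i j} → Adj (u j) (v i j)
  vu  : ∀ {i j} → Adj (v i j) (u j)
  u0u : ∀ {j} → Adj u0 (u j)
  uu0 : ∀ {j} → Adj (u j) u0

VSet : ℕ → ℕ → Set
VSet k r = Vertex k r → Bool

_∈_ : ∀ {k r} → Vertex k r → VSet k r → Set
w ∈ X = X w ≡ true

_⊆_ : ∀ {k r} → VSet k r → VSet k r → Set
Y ⊆ X = ∀ w → w ∈ Y → w ∈ X

_⊂_ : ∀ {k r} → VSet k r → VSet k r → Set
Y ⊂ X = (Y ⊆ X) × ∃ λ w → (w ∈ X) × ¬ (w ∈ Y)

Dominating : ∀ {k r} → VSet k r → Set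
Dominating {k} {r} X = ∀ (w : Vertex k r) → (w ∈ X) ⊎ (∃ λ x → (x ∈ X) × Adj x w)

MinimalDominating : ∀ {k r} → VSet k r → Set
MinimalDominating X = Dominating X × (∀ Y → Y ⊂ X → ¬ Dominating Y)

cardV : ∀ {k r} → VSet k r → Fin r → ℕ
cardV {k} X i = length (filter (λ j → X (v i j) ≟ true) (allFin k))

MeetsV : ∀ {k r} → VSet k r → Fin r → Set
MeetsV X i = ∃ λ j → v i j ∈ X

MeetsU0 : ∀ {k r} → VSet k r → Set
MeetsU0 X = (u0 ∈ X) ⊎ (∃ λ j → u j ∈ X)

UinX : ∀ {k r} → VSet k r → Set
UinX X = ∀ j → u j ∈ X

IsU : ∀ {k r} → VSet k r → Set
IsU {k} {r} X = ∀ (w : Vertex k r) → ((w ∈ X) → IsUVertex w) × (IsUVertex w → w ∈ X)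
  where
  IsUVertex : Vertex k r → Set
  IsUVertex (u _)   = ⊤
  IsUVertex u0      = ⊥
  IsUVertex (v _ _) = ⊥

U0is-u0 : ∀ {k r} → VSet k r → Set
U0is-u0 X = (u0 ∈ X) × (∀ j → ¬ (u j ∈ X))

-- Minimality is used only through one principle: a member x of a minimal
-- dominating set X cannot be redundant, i.e. some vertex of the closed
-- neighbourhood of x is dominated by no vertex of X other than x.
-- (c) Two members of one clique V_i make each other redundant, as X meets U_0 by (a).
-- (d) A member of U makes u_0 redundant.
-- (e) If X misses V_i then U ⊆ X by (b), so no vertex of V_1, …, V_r is needed
-- and, by (d), neither is u_0.
module Submission where

open import Defs
open import Data.Nat using (ℕ; _≤_; _<_; z≤n; s≤s; zero; suc)
open import Data.Nat.Properties using (≤-reflexive; ≤-trans)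
open import Data.Fin using (Fin; zero; suc)
open import Data.Fin.Properties using (suc-injective; 0≢1+n; ¬∀⟶∃¬) renaming (_≟_ to _≟ᶠ_)
open import Data.Bool using (true; false; if_then_else_)
open import Data.Bool.Properties using () renaming (_≟_ to _≟ᵇ_)
open import Data.Product using (_×_; ∃; _,_; proj₁; proj₂)
open import Data.Sum using (_⊎_; inj₁; inj₂)
open import Data.Unit using (tt)
open import Data.List using (length; filter; tabulate)
open import Data.List.Properties using (filter-none)
open import Data.List.Relation.Unary.All.Properties using (tabulate⁺)
open import Function using (_∘_; id)
open import Relation.Unary using (Pred; Decidable)
open import Relation.Nullary using (¬_; Dec; yes; no; does; contradiction)
open import Relation.Nullary.Decidable using (map′; _×-dec_; dec-false; decidable-stable)
open import Relation.Binary.PropositionalEquality using (_≡_; _≢_; refl; cong; cong₂; sym)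

length-filter-tabulate-≤1 : ∀ {a p} {A : Set a} {P : Pred A p} (P? : Decidable P) {n} (f : Fin n → A) →
                            (∀ i j → P (f i) → P (f j) → i ≡ j) → length (filter P? (tabulate f)) ≤ 1
length-filter-tabulate-≤1 P? {zero} _ _ = z≤n
length-filter-tabulate-≤1 P? {suc n} f unique with P? (f zero)
... | yes p₀ = ≤-reflexive (cong (suc ∘ length)
                 (filter-none P? (tabulate⁺ λ i p → 0≢1+n (unique zero (suc i) p₀ p))))
... | no _   = length-filter-tabulate-≤1 P? (f ∘ suc)
                 λ i j pᵢ pⱼ → suc-injective (unique (suc i) (suc j) pᵢ pⱼ)

module _ {k r : ℕ} where

  u-injective : {a b : Fin k} → u {k} {r} a ≡ u b → a ≡ b
  u-injective refl = refl

  v-injective : {i i′ : Fin r} {a b : Fin k} → v {k} {r} i a ≡ v i′ b → i ≡ i′ × a ≡ b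
  v-injective refl = refl , refl

  _≟_ : (x y : Vertex k r) → Dec (x ≡ y)
  u a   ≟ u b    = map′ (cong u) u-injective (a ≟ᶠ b)
  u0    ≟ u0     = yes refl
  v i a ≟ v i′ b = map′ (λ (i≡i′ , a≡b) → cong₂ v i≡i′ a≡b) v-injective
                        ((i ≟ᶠ i′) ×-dec (a ≟ᶠ b))
  u _   ≟ u0     = no λ ()
  u _   ≟ v _ _  = no λ ()
  u0    ≟ u _    = no λ ()
  u0    ≟ v _ _  = no λ ()
  v _ _ ≟ u _    = no λ ()
  v _ _ ≟ u0     = no λ ()

  infixl 25 _─_
  _─_ : VSet k r → Vertex k r → VSet k r
  (X ─ x) w = if does (w ≟ x) then false else X w

  ∈-─ : ∀ {X : VSet k r} {x w} → w ∈ X → w ≢ x → w ∈ X ─ x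
  ∈-─ {w = w} w∈X w≢x rewrite dec-false (w ≟ _) w≢x = w∈X

  ─-⊆ : ∀ {X : VSet k r} {x} → X ─ x ⊆ X
  ─-⊆ {x = x} w w∈X─x with w ≟ x
  ... | no _ = w∈X─x

  ∉-─ : ∀ {X : VSet k r} {x} → ¬ (x ∈ X ─ x)
  ∉-─ {x = x} x∈X─x with x ≟ x
  ... | no x≢x = x≢x refl

  Dominates : Vertex k r → Vertex k r → Set
  Dominates y w = y ≡ w ⊎ Adj y w

  DominatedBy : VSet k r → Vertex k r → Set
  DominatedBy Y w = (w ∈ Y) ⊎ ∃ λ y → (y ∈ Y) × Adj y w

  Redundant : VSet k r → Vertex k r → Set
  Redundant X x = ∀ w → Dominates x w → ∃ λ y → y ∈ X × y ≢ x × Dominates y w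

  dominatedBy-─ : ∀ {X : VSet k r} {x y w} → y ∈ X → y ≢ x → Dominates y w → DominatedBy (X ─ x) w
  dominatedBy-─ {X} y∈X y≢x (inj₁ refl) = inj₁ (∈-─ {X} y∈X y≢x)
  dominatedBy-─ {X} y∈X y≢x (inj₂ y~w)  = inj₂ (_ , ∈-─ {X} y∈X y≢x , y~w)

  redundant⇒dominatedBy-─ : ∀ {X : VSet k r} {x y w} →
                            Redundant X x → y ∈ X → Dominates y w → DominatedBy (X ─ x) w
  redundant⇒dominatedBy-─ {x = x} {y} {w} red y∈X y⇒w with y ≟ x
  ... | yes refl = let z , z∈X , z≢x , z⇒w = red w y⇒w in dominatedBy-─ z∈X z≢x z⇒w
  ... | no y≢x   = dominatedBy-─ y∈X y≢x y⇒w

  dominating-─ : ∀ {X : VSet k r} {x} → Dominating X → Redundant X x → Dominating (X ─ x)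
  dominating-─ dom red w with dom w
  ... | inj₁ w∈X             = redundant⇒dominatedBy-─ red w∈X (inj₁ refl)
  ... | inj₂ (y , y∈X , y~w) = redundant⇒dominatedBy-─ red y∈X (inj₂ y~w)

  minimal⇒¬redundant : ∀ {X : VSet k r} {x} → MinimalDominating X → x ∈ X → ¬ Redundant X x
  minimal⇒¬redundant {X} {x} (dom , minimal) x∈X red =
    minimal (X ─ x) (─-⊆ , x , x∈X , ∉-─ {X}) (dominating-─ dom red)

  U-dominates-U : ∀ a b → Dominates (u {k} {r} a) (u b)
  U-dominates-U a b with a ≟ᶠ b
  ... | yes refl = inj₁ refl
  ... | no a≢b   = inj₂ (uu a≢b)

  V-dominates-V : ∀ i a b → Dominates (v {k} {r} i a) (v i b)
  V-dominates-V i a b with a ≟ᶠ b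
  ... | yes refl = inj₁ refl
  ... | no a≢b   = inj₂ (vv a≢b)

  dominating⇒meetsU0 : ∀ {X : VSet k r} → Dominating X → MeetsU0 X
  dominating⇒meetsU0 dom with dom u0
  ... | inj₁ u0∈X               = inj₁ u0∈X
  ... | inj₂ (u j , uj∈X , uu0) = inj₂ (j , uj∈X)

  meetsU0⇒dominates-U : ∀ {X : VSet k r} {i j} → MeetsU0 X →
                        ∀ a → ∃ λ y → y ∈ X × y ≢ v i j × Dominates y (u a)
  meetsU0⇒dominates-U (inj₁ u0∈X)       a = u0 , u0∈X , (λ ()) , inj₂ u0u
  meetsU0⇒dominates-U (inj₂ (b , ub∈X)) a = u b , ub∈X , (λ ()) , U-dominates-U b a

  u∉⇒meetsV : ∀ {X : VSet k r} {j} → Dominating X → ¬ (u j ∈ X) → ∀ i → MeetsV X i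
  u∉⇒meetsV {j = j} dom uj∉X i with dom (v i j)
  ... | inj₁ vij∈X               = j , vij∈X
  ... | inj₂ (v _ j′ , p , vv _) = j′ , p
  ... | inj₂ (u _ , uj∈X , uv)   = contradiction uj∈X uj∉X

  minimal⇒V-unique : ∀ {X : VSet k r} → MinimalDominating X →
                     ∀ i a b → v i a ∈ X → v i b ∈ X → a ≡ b
  minimal⇒V-unique {X} min i a b via∈X vib∈X with a ≟ᶠ b
  ... | yes a≡b = a≡b
  ... | no a≢b  = contradiction redundant (minimal⇒¬redundant min via∈X)
    where
    vib≢via : v i b ≢ v i a
    vib≢via = a≢b ∘ sym ∘ proj₂ ∘ v-injective
    redundant : Redundant X (v i a)
    redundant _ (inj₁ refl)         = v i b , vib∈X , vib≢via , V-dominates-V i b a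
    redundant (v _ j) (inj₂ (vv _)) = v i b , vib∈X , vib≢via , V-dominates-V i b j
    redundant (u _) (inj₂ vu)       = meetsU0⇒dominates-U (dominating⇒meetsU0 (proj₁ min)) a

  minimal⇒U0is-u0 : ∀ {X : VSet k r} → MinimalDominating X → u0 ∈ X → U0is-u0 X
  minimal⇒U0is-u0 {X} min u0∈X =
    u0∈X , λ j uj∈X → minimal⇒¬redundant min u0∈X (redundant j uj∈X)
    where
    redundant : ∀ j → u j ∈ X → Redundant X u0
    redundant j uj∈X _ (inj₁ refl)     = u j , uj∈X , (λ ()) , inj₂ uu0
    redundant j uj∈X (u j′) (inj₂ u0u) = u j , uj∈X , (λ ()) , U-dominates-U j j′

  minimal⇒IsU : ∀ {X : VSet k r} → 1 ≤ k → MinimalDominating X → (∃ λ i → ¬ MeetsV X i) → IsU X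
  minimal⇒IsU {X} (s≤s _) min (i , X∩Vᵢ≡∅) = λ
    { (u j)    → (λ _ → tt) , (λ _ → U⊆X j)
    ; u0       → (λ u0∈X → proj₂ (minimal⇒U0is-u0 min u0∈X) zero (U⊆X zero)) , (λ ())
    ; (v i′ j) → (λ vi′j∈X → minimal⇒¬redundant min vi′j∈X (redundant i′ j)) , (λ ())
    }
    where
    U⊆X : UinX X
    U⊆X j = decidable-stable (X (u j) ≟ᵇ true)
              λ uj∉X → X∩Vᵢ≡∅ (u∉⇒meetsV (proj₁ min) uj∉X i)
    redundant : ∀ i′ j → Redundant X (v i′ j)
    redundant i′ j _ (inj₁ refl)          = u j , U⊆X j , (λ ()) , inj₂ uv
    redundant i′ j (v _ j′) (inj₂ (vv _)) = u j′ , U⊆X j′ , (λ ()) , inj₂ uv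
    redundant i′ j (u _) (inj₂ vu)        = u j , U⊆X j , (λ ()) , inj₁ refl

lemma6 : (k r : ℕ) → 3 ≤ k → 1 ≤ r → r < k → (X : VSet k r) → Dominating X →
           MeetsU0 X
           × (¬ UinX X → ∀ (i : Fin r) → MeetsV X i)
           × (MinimalDominating X →
                (∀ (i : Fin r) → cardV X i ≤ 1)
                × (u0 ∈ X → U0is-u0 X)
                × ((∃ λ (i : Fin r) → ¬ MeetsV X i) → IsU X))
lemma6 k r 3≤k _ _ X dom =
  dominating⇒meetsU0 {X = X} dom ,
  (λ U⊈X → u∉⇒meetsV {X = X} dom (proj₂ (¬∀⟶∃¬ k _ (λ j → X (u j) ≟ᵇ true) U⊈X))) ,
  λ min → (λ i → length-filter-tabulate-≤1 _ id (minimal⇒V-unique {X = X} min i))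
        , minimal⇒U0is-u0 {X = X} min
        , minimal⇒IsU {X = X} (≤-trans (s≤s z≤n) 3≤k) min
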